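{- Let $\mathbb{F}$ be a field, let $a$ be a non-zero element of $\mathbb{F}$, and let $\vec{\mathcal{S}^m}$ be an oriented triangular sphere with $m$ triangles. Then the kernel over $\mathbb{F}$ of $\vec{\mathcal{S}^m}$ is the one-dimensional space spanned by the vector $v$ with $v^t=a$ for every triangle $t$ with sign $+$ and $v^t=-a$ for every triangle $t$ with sign $-$.
   Context: An oriented triangular sphere $\vec{\mathcal{S}^m}$ is a triangulation of the 2-dimensional sphere by $m$ triangles (viewed as a 2-dimensional simplicial complex) together with an assignment of a sign $+$ or $-$ to each triangle such that every edge is incident with exactly one $+$ triangle and one $-$ triangle. Its kernel is the kernel over $\mathbb{F}$ of the incidence matrix with rows indexed by edges and columns by triangles, entry $1$ if the edge belongs to the triangle and $0$ otherwise. -}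

module Defs where

open import Level using (Level; _⊔_) renaming (suc to lsuc)
open import Data.Nat using (ℕ; zero; suc)
open import Data.Bool using (Bool; true; false; if_then_else_; _∧_; _∨_; not)
open import Data.Fin using (Fin; toℕ) renaming (zero to fzero; suc to fsuc)
open import Data.Fin.Base using (_<_)
import Data.Fin as F
import Data.Nat as N
open import Data.Product using (Σ; ∃; ∃-syntax; _×_; _,_)
open import Data.Sum using (_⊎_)
open import Relation.Nullary using (¬_)
open import Relation.Nullary.Decidable using (⌊_⌋)
open import Relation.Binary.PropositionalEquality using (_≡_)
open import Relation.Binary.Construct.Closure.ReflexiveTransitive using (Star)
open import Algebra.Bundles using (CommutativeRing)

record Field (c ℓ : Level) : Set (lsuc (c ⊔ ℓ)) where
  field
    commutativeRing : CommutativeRing c ℓ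
  open CommutativeRing commutativeRing public
  field
    0≉1     : ¬ (0# ≈ 1#)
    inverse : ∀ x → ¬ (x ≈ 0#) → ∃[ y ] (x * y ≈ 1#)

count : ∀ {k} → (Fin k → Bool) → ℕ
count {zero}  p = 0
count {suc k} p = (if p fzero then 1 else 0) N.+ count (λ i → p (fsuc i))

sumℕ : ∀ {k} → (Fin k → ℕ) → ℕ
sumℕ {zero}  f = 0
sumℕ {suc k} f = f fzero N.+ sumℕ (λ i → f (fsuc i))

count₂ : ∀ {k} → (Fin k → Fin k → Bool) → ℕ
count₂ p = sumℕ (λ i → count (p i))

-- Pure 2-dimensional simplicial complexes on the vertex set Fin n,
-- given by their triangles (2-simplices).  A triangle is a 3-element
-- vertex set, stored as a strictly increasing triple.

record Tri (n : ℕ) : Set where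
  constructor tri
  field
    v₀ v₁ v₂ : Fin n
    v₀<v₁    : v₀ < v₁
    v₁<v₂    : v₁ < v₂
open Tri public

_∈ᵗ_ : ∀ {n} → Fin n → Tri n → Set
u ∈ᵗ t = (u ≡ v₀ t) ⊎ (u ≡ v₁ t) ⊎ (u ≡ v₂ t)

_∈ᵇ_ : ∀ {n} → Fin n → Tri n → Bool
u ∈ᵇ t = ⌊ u F.≟ v₀ t ⌋ ∨ ⌊ u F.≟ v₁ t ⌋ ∨ ⌊ u F.≟ v₂ t ⌋

SameTri : ∀ {n} → Tri n → Tri n → Set
SameTri s t = (v₀ s ≡ v₀ t) × (v₁ s ≡ v₁ t) × (v₂ s ≡ v₂ t)

Complex : ℕ → ℕ → Set
Complex n m = Fin m → Tri n

-- An (unordered) pair of vertices, stored as u < v.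
record Pair (n : ℕ) : Set where
  constructor pair
  field
    p₀ p₁ : Fin n
    p₀<p₁ : p₀ < p₁
open Pair public

_⊆ᵗ_ : ∀ {n} → Pair n → Tri n → Set
e ⊆ᵗ t = (p₀ e ∈ᵗ t) × (p₁ e ∈ᵗ t)

_⊆ᵇ_ : ∀ {n} → Pair n → Tri n → Bool
e ⊆ᵇ t = (p₀ e ∈ᵇ t) ∧ (p₁ e ∈ᵇ t)

module _ {n m : ℕ} (K : Complex n m) where

  IsEdge : Pair n → Set
  IsEdge e = ∃[ t ] (e ⊆ᵗ K t)

  numEdges : ℕ
  numEdges = count₂ {n} λ u v →
    ⌊ toℕ u N.<? toℕ v ⌋ ∧
    not (count {m} (λ t → (u ∈ᵇ K t) ∧ (v ∈ᵇ K t)) N.≡ᵇ 0)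

  Adj : Fin n → Fin n → Set
  Adj u v = ¬ (u ≡ v) × ∃[ t ] ((u ∈ᵗ K t) × (v ∈ᵗ K t))

  LinkAdj : Fin n → Fin n → Fin n → Set
  LinkAdj w u v = ¬ (u ≡ v) × ¬ (w ≡ u) × ¬ (w ≡ v) ×
                  ∃[ t ] ((w ∈ᵗ K t) × (u ∈ᵗ K t) × (v ∈ᵗ K t))

  -- K is a triangulated 2-sphere (combinatorial description):
  --  * distinct triangles have distinct vertex sets (simplicial complex),
  --  * every vertex lies in some triangle (pure, vertex set exactly Fin n),
  --  * every edge lies in exactly two triangles (closed pseudomanifold),
  --  * the link of every vertex is connected (hence a single cycle),
  --    so |K| is a closed surface,
  --  * K is connected,
  --  * Euler characteristic V - E + F = 2.
  record IsTriangulatedSphere : Set where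
    field
      simplicial    : ∀ s t → SameTri (K s) (K t) → s ≡ t
      pure          : ∀ u → ∃[ t ] (u ∈ᵗ K t)
      edgeTwo       : ∀ e → IsEdge e →
                        ∃[ s ] ∃[ t ] (¬ (s ≡ t) × e ⊆ᵗ K s × e ⊆ᵗ K t ×
                          (∀ r → e ⊆ᵗ K r → (r ≡ s) ⊎ (r ≡ t)))
      linkConnected : ∀ w u v → Adj w u → Adj w v → Star (LinkAdj w) u v
      connected     : ∀ u v → Star Adj u v
      euler         : n N.+ m ≡ 2 N.+ numEdges

data Sign : Set where
  plus minus : Sign

record OrientedSphere (n m : ℕ) : Set where
  field
    complex   : Complex n m
    isSphere  : IsTriangulatedSphere complex
    sign      : Fin m → Sign
    orientedP : ∀ e → IsEdge complex e →
                  ∃[ t ] (sign t ≡ plus × e ⊆ᵗ complex t ×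
                    (∀ r → sign r ≡ plus → e ⊆ᵗ complex r → r ≡ t))
    orientedM : ∀ e → IsEdge complex e →
                  ∃[ t ] (sign t ≡ minus × e ⊆ᵗ complex t ×
                    (∀ r → sign r ≡ minus → e ⊆ᵗ complex r → r ≡ t))

module _ {c ℓ : Level} (𝔽 : Field c ℓ) where
  open Field 𝔽

  ∑ : ∀ {k} → (Fin k → Carrier) → Carrier
  ∑ {zero}  f = 0#
  ∑ {suc k} f = f fzero + ∑ (λ i → f (fsuc i))

  -- incidence matrix entry: rows = edges, columns = triangles
  incidence : ∀ {n m} → Complex n m → Pair n → Fin m → Carrier
  incidence K e t = if e ⊆ᵇ K t then 1# else 0#

  InKernel : ∀ {n m} → Complex n m → (Fin m → Carrier) → Set ℓ
  InKernel {m = m} K x =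
    ∀ e → IsEdge K e → ∑ {m} (λ t → incidence K e t * x t) ≈ 0#

  KernelIsSpanOf : ∀ {n m} → Complex n m → (Fin m → Carrier) → Set (c ⊔ ℓ)
  KernelIsSpanOf {m = m} K v =
    (¬ (∀ t → v t ≈ 0#)) ×
    (∀ (λ' : Carrier) → InKernel K (λ t → λ' * v t)) ×
    (∀ x → InKernel K x → ∃[ λ' ] (∀ t → x t ≈ λ' * v t))

  signedVector : ∀ {m} → (Fin m → Sign) → Carrier → Fin m → Carrier
  signedVector σ a t with σ t
  ... | plus  = a
  ... | minus = - a

-- Each edge lies in exactly one + and one − triangle, so the kernel equations
-- are  x t₊ + x t₋ ≈ 0,  one per edge: the signed vector satisfies them, and
-- for a kernel vector, vanishing on a triangle passes to every triangle sharing
-- an edge with it.  Around a vertex the triangles are linked through edges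
-- (the link is connected), and the 1-skeleton is connected, so the property
-- spreads to the whole sphere.  Hence a kernel vector vanishing on one triangle
-- vanishes identically, and the kernel is one-dimensional.
module Submission where

open import Defs
open import Level using (Level)
open import Data.Nat using (ℕ; zero; suc)
open import Data.Fin using (Fin) renaming (zero to fzero; suc to fsuc)
import Data.Fin as F
import Data.Fin.Properties as FP
open import Data.Bool using (true; false)
open import Data.Product using (∃-syntax; _×_; _,_; proj₁; proj₂)
open import Data.Sum using (_⊎_; inj₁; inj₂; [_,_]′)
open import Data.Empty using (⊥-elim)
open import Function using (id; _∘_)
open import Relation.Nullary using (¬_; yes; no)
open import Relation.Binary.Core using (Rel)
open import Relation.Binary.Definitions using (tri<; tri≈; tri>)
open import Relation.Binary.PropositionalEquality as ≡ using (_≡_; _≢_)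
open import Relation.Binary.Construct.Closure.ReflexiveTransitive using (Star; fold)
import Algebra.Properties.Ring as RingProperties
import Algebra.Properties.CommutativeSemigroup as CommutativeSemigroupProperties

∈ᵇ⇒∈ᵗ : ∀ {n} (u : Fin n) (t : Tri n) → u ∈ᵇ t ≡ true → u ∈ᵗ t
∈ᵇ⇒∈ᵗ u t eq with u F.≟ v₀ t | u F.≟ v₁ t | u F.≟ v₂ t
... | yes p | _     | _     = inj₁ p
... | no _  | yes p | _     = inj₂ (inj₁ p)
... | no _  | no _  | yes p = inj₂ (inj₂ p)

∈ᵗ⇒∈ᵇ : ∀ {n} (u : Fin n) (t : Tri n) → u ∈ᵗ t → u ∈ᵇ t ≡ true
∈ᵗ⇒∈ᵇ u t u∈t with u F.≟ v₀ t | u F.≟ v₁ t | u F.≟ v₂ t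
... | yes _ | _     | _     = ≡.refl
... | no _  | yes _ | _     = ≡.refl
... | no _  | no _  | yes _ = ≡.refl
... | no ¬p | no ¬q | no ¬r = ⊥-elim ([ ¬p , [ ¬q , ¬r ]′ ]′ u∈t)

⊆ᵇ⇒⊆ᵗ : ∀ {n} (e : Pair n) (t : Tri n) → e ⊆ᵇ t ≡ true → e ⊆ᵗ t
⊆ᵇ⇒⊆ᵗ e t eq with p₀ e ∈ᵇ t in eq₀ | p₁ e ∈ᵇ t in eq₁
... | true | true = ∈ᵇ⇒∈ᵗ _ t eq₀ , ∈ᵇ⇒∈ᵗ _ t eq₁

⊆ᵗ⇒⊆ᵇ : ∀ {n} (e : Pair n) (t : Tri n) → e ⊆ᵗ t → e ⊆ᵇ t ≡ true
⊆ᵗ⇒⊆ᵇ e t (p₀∈t , p₁∈t) rewrite ∈ᵗ⇒∈ᵇ _ t p₀∈t | ∈ᵗ⇒∈ᵇ _ t p₁∈t = ≡.refl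

pairOf : ∀ {n} (u v : Fin n) → u ≢ v → Pair n
pairOf u v u≢v with FP.<-cmp u v
... | tri< u<v _ _ = pair u v u<v
... | tri≈ _ u≡v _ = ⊥-elim (u≢v u≡v)
... | tri> _ _ v<u = pair v u v<u

pairOf-⊆ᵗ : ∀ {n} {u v : Fin n} (u≢v : u ≢ v) (t : Tri n) →
            u ∈ᵗ t → v ∈ᵗ t → pairOf u v u≢v ⊆ᵗ t
pairOf-⊆ᵗ {u = u} {v} u≢v t u∈t v∈t with FP.<-cmp u v
... | tri< _ _ _   = u∈t , v∈t
... | tri≈ _ u≡v _ = ⊥-elim (u≢v u≡v)
... | tri> _ _ _   = v∈t , u∈t

∃-vertex-≢ : ∀ {n} (w : Fin n) (t : Tri n) → ∃[ u ] (u ∈ᵗ t × w ≢ u)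
∃-vertex-≢ w t with w F.≟ v₀ t
... | yes ≡.refl = v₁ t , inj₂ (inj₁ ≡.refl) , FP.<⇒≢ (v₀<v₁ t)
... | no w≢v₀  = v₀ t , inj₁ ≡.refl , w≢v₀

star-preserves : ∀ {a r q} {A : Set a} {R : Rel A r} (Q : A → Set q) →
                 (∀ {i j} → R i j → Q i → Q j) → ∀ {i j} → Star R i j → Q i → Q j
star-preserves Q step = fold (λ i j → Q i → Q j) (λ r k → k ∘ step r) id

-- With no vertices at all, Euler's formula still forces m = 2 + |E| ≥ 2.
someTriangle : ∀ {n m} {K : Complex n m} → IsTriangulatedSphere K → Fin m
someTriangle {zero}  sphere = ≡.subst Fin (≡.sym (IsTriangulatedSphere.euler sphere)) fzero
someTriangle {suc _} sphere = proj₁ (IsTriangulatedSphere.pure sphere fzero)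

module _ {n m : ℕ} {K : Complex n m} (sphere : IsTriangulatedSphere K) where
  open IsTriangulatedSphere sphere

  EdgeClosed : ∀ {p} → (Fin m → Set p) → Set p
  EdgeClosed P = ∀ e {s t} → e ⊆ᵗ K s → e ⊆ᵗ K t → P s → P t

  module _ {p} {P : Fin m → Set p} (closed : EdgeClosed P) where

    private
      AroundVertex : Fin n → Set p
      AroundVertex w = ∀ r → w ∈ᵗ K r → P r

      AroundEdge : Fin n → Fin n → Set p
      AroundEdge w u = ∀ r → w ∈ᵗ K r → u ∈ᵗ K r → P r

      aroundEdge-transport : ∀ {w u v} → Star (LinkAdj K w) u v →
                             AroundEdge w u → AroundEdge w v
      aroundEdge-transport {w} = star-preserves (AroundEdge w) step
        where
        step : ∀ {u v} → LinkAdj K w u v → AroundEdge w u → AroundEdge w v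
        step (_ , _ , w≢v , t , w∈t , u∈t , v∈t) Pwu r w∈r v∈r =
          closed (pairOf _ _ w≢v) (pairOf-⊆ᵗ w≢v (K t) w∈t v∈t) (pairOf-⊆ᵗ w≢v (K r) w∈r v∈r)
                 (Pwu t w∈t u∈t)

      aroundVertex : ∀ {w s} → w ∈ᵗ K s → P s → AroundVertex w
      aroundVertex {w} {s} w∈s Ps t w∈t
        with ∃-vertex-≢ w (K s) | ∃-vertex-≢ w (K t)
      ... | u , u∈s , w≢u | u' , u'∈t , w≢u' =
        aroundEdge-transport (linkConnected w u u' (w≢u , s , w∈s , u∈s) (w≢u' , t , w∈t , u'∈t))
                             Pwu t w∈t u'∈t
        where
        Pwu : AroundEdge w u
        Pwu r w∈r u∈r =
          closed (pairOf _ _ w≢u) (pairOf-⊆ᵗ w≢u (K s) w∈s u∈s) (pairOf-⊆ᵗ w≢u (K r) w∈r u∈r) Ps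

      aroundVertex-transport : ∀ {u v} → Star (Adj K) u v → AroundVertex u → AroundVertex v
      aroundVertex-transport = star-preserves AroundVertex step
        where
        step : ∀ {u v} → Adj K u v → AroundVertex u → AroundVertex v
        step (_ , t , u∈t , v∈t) Pu = aroundVertex v∈t (Pu t u∈t)

    edgeClosed⇒everywhere : ∀ {s} → P s → ∀ t → P t
    edgeClosed⇒everywhere Ps t =
      aroundVertex-transport (connected _ _) (aroundVertex (inj₁ ≡.refl) Ps) t (inj₁ ≡.refl)

module _ {c ℓ : Level} (𝔽 : Field c ℓ) where
  open Field 𝔽
  open RingProperties ring
  open import Relation.Binary.Reasoning.Setoid setoid

  ∑-vanishing : ∀ {k} {f : Fin k → Carrier} → (∀ i → f i ≈ 0#) → ∑ 𝔽 f ≈ 0#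
  ∑-vanishing {zero}  f≈0 = refl
  ∑-vanishing {suc k} f≈0 =
    trans (+-cong (f≈0 fzero) (∑-vanishing (f≈0 ∘ fsuc))) (+-identityˡ 0#)

  ∑-supported-on-single : ∀ {k} {f : Fin k → Carrier} (s : Fin k) →
                          (∀ i → i ≢ s → f i ≈ 0#) → ∑ 𝔽 f ≈ f s
  ∑-supported-on-single fzero f≈0 =
    trans (+-congˡ (∑-vanishing (λ i → f≈0 (fsuc i) λ ()))) (+-identityʳ _)
  ∑-supported-on-single (fsuc s) f≈0 =
    trans (+-congʳ (f≈0 fzero λ ()))
          (trans (+-identityˡ _) (∑-supported-on-single s (λ i i≢s → f≈0 (fsuc i) (i≢s ∘ FP.suc-injective))))

  ∑-supported-on-pair : ∀ {k} {f : Fin k → Carrier} {s t : Fin k} → s ≢ t →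
                        (∀ i → i ≢ s → i ≢ t → f i ≈ 0#) → ∑ 𝔽 f ≈ f s + f t
  ∑-supported-on-pair {s = fzero} {fzero} s≢t f≈0 = ⊥-elim (s≢t ≡.refl)
  ∑-supported-on-pair {s = fzero} {fsuc t} s≢t f≈0 =
    +-congˡ (∑-supported-on-single t (λ i i≢t → f≈0 (fsuc i) (λ ()) (i≢t ∘ FP.suc-injective)))
  ∑-supported-on-pair {s = fsuc s} {fzero} s≢t f≈0 =
    trans (+-congˡ (∑-supported-on-single s (λ i i≢s → f≈0 (fsuc i) (i≢s ∘ FP.suc-injective) (λ ()))))
          (+-comm _ _)
  ∑-supported-on-pair {s = fsuc s} {fsuc t} s≢t f≈0 =
    trans (+-congʳ (f≈0 fzero (λ ()) (λ ())))
          (trans (+-identityˡ _)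
                 (∑-supported-on-pair (s≢t ∘ ≡.cong fsuc)
                    (λ i i≢s i≢t → f≈0 (fsuc i) (i≢s ∘ FP.suc-injective) (i≢t ∘ FP.suc-injective))))

  x+y≈0∧x≈0⇒y≈0 : ∀ {x y} → x + y ≈ 0# → x ≈ 0# → y ≈ 0#
  x+y≈0∧x≈0⇒y≈0 {x} {y} x+y≈0 x≈0 = begin
    y      ≈⟨ +-identityˡ y ⟨
    0# + y ≈⟨ +-congʳ x≈0 ⟨
    x + y  ≈⟨ x+y≈0 ⟩
    0#     ∎

  x-y≈0⇒x≈y : ∀ {x y} → x + - y ≈ 0# → x ≈ y
  x-y≈0⇒x≈y {x} {y} x-y≈0 = trans (+-inverseˡ-unique x (- y) x-y≈0) (-‿involutive y)

  signedVector≉0 : ∀ {a} → ¬ a ≈ 0# → ∀ {k} (σ : Fin k → Sign) t → ¬ signedVector 𝔽 σ a t ≈ 0#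
  signedVector≉0 {a} a≉0 σ t with σ t
  ... | plus  = a≉0
  ... | minus = λ -a≈0 → a≉0 (begin
    a     ≈⟨ -‿involutive a ⟨
    - - a ≈⟨ -‿cong -a≈0 ⟩
    - 0#  ≈⟨ -0#≈0# ⟩
    0#    ∎)

module OrientedKernel {c ℓ : Level} (𝔽 : Field c ℓ) {n m : ℕ} (S : OrientedSphere n m) where
  open Field 𝔽
  open RingProperties ring
  open CommutativeSemigroupProperties +-commutativeSemigroup using (interchange)
  open import Relation.Binary.Reasoning.Setoid setoid
  open OrientedSphere S renaming (complex to K)

  plusTriangle minusTriangle : ∀ e → IsEdge K e → Fin m
  plusTriangle  e ie = proj₁ (orientedP e ie)
  minusTriangle e ie = proj₁ (orientedM e ie)

  plusTriangle≢minusTriangle : ∀ e ie → plusTriangle e ie ≢ minusTriangle e ie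
  plusTriangle≢minusTriangle e ie p≡m
    with ≡.trans (≡.sym (proj₁ (proj₂ (orientedP e ie))))
           (≡.trans (≡.cong sign p≡m) (proj₁ (proj₂ (orientedM e ie))))
  ... | ()

  triangle-on-edge : ∀ e ie {t} → e ⊆ᵗ K t → t ≡ plusTriangle e ie ⊎ t ≡ minusTriangle e ie
  triangle-on-edge e ie {t} e⊆t with sign t in st
  ... | plus  = inj₁ (proj₂ (proj₂ (proj₂ (orientedP e ie))) t st e⊆t)
  ... | minus = inj₂ (proj₂ (proj₂ (proj₂ (orientedM e ie))) t st e⊆t)

  incidence-⊆ᵗ : ∀ e t → e ⊆ᵗ K t → incidence 𝔽 K e t ≡ 1#
  incidence-⊆ᵗ e t e⊆t rewrite ⊆ᵗ⇒⊆ᵇ e (K t) e⊆t = ≡.refl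

  incidence-⊈ᵗ : ∀ e t → ¬ e ⊆ᵗ K t → incidence 𝔽 K e t ≡ 0#
  incidence-⊈ᵗ e t e⊈t with e ⊆ᵇ K t in eq
  ... | true  = ⊥-elim (e⊈t (⊆ᵇ⇒⊆ᵗ e (K t) eq))
  ... | false = ≡.refl

  ∑-incidence : ∀ e ie (y : Fin m → Carrier) →
                ∑ 𝔽 (λ t → incidence 𝔽 K e t * y t) ≈ y (plusTriangle e ie) + y (minusTriangle e ie)
  ∑-incidence e ie y = begin
    ∑ 𝔽 (λ t → incidence 𝔽 K e t * y t)
      ≈⟨ ∑-supported-on-pair 𝔽 (plusTriangle≢minusTriangle e ie) off-edge ⟩
    incidence 𝔽 K e t₊ * y t₊ + incidence 𝔽 K e t₋ * y t₋
      ≈⟨ +-cong (on-edge (proj₁ (proj₂ (proj₂ (orientedP e ie)))))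
                (on-edge (proj₁ (proj₂ (proj₂ (orientedM e ie))))) ⟩
    y t₊ + y t₋ ∎
    where
    t₊ = plusTriangle e ie
    t₋ = minusTriangle e ie

    on-edge : ∀ {t} → e ⊆ᵗ K t → incidence 𝔽 K e t * y t ≈ y t
    on-edge {t} e⊆t = trans (reflexive (≡.cong (_* y t) (incidence-⊆ᵗ e t e⊆t))) (*-identityˡ (y t))

    off-edge : ∀ t → t ≢ t₊ → t ≢ t₋ → incidence 𝔽 K e t * y t ≈ 0#
    off-edge t t≢t₊ t≢t₋ =
      trans (reflexive (≡.cong (_* y t) (incidence-⊈ᵗ e t ([ t≢t₊ , t≢t₋ ]′ ∘ triangle-on-edge e ie))))
            (zeroˡ (y t))

  Balanced : (Fin m → Carrier) → Set ℓ
  Balanced x = ∀ e ie → x (plusTriangle e ie) + x (minusTriangle e ie) ≈ 0#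

  inKernel⇒balanced : ∀ x → InKernel 𝔽 K x → Balanced x
  inKernel⇒balanced x ker e ie = trans (sym (∑-incidence e ie x)) (ker e ie)

  balanced⇒inKernel : ∀ x → Balanced x → InKernel 𝔽 K x
  balanced⇒inKernel x bal e ie = trans (∑-incidence e ie x) (bal e ie)

  balanced-scale : ∀ λ' x → Balanced x → Balanced (λ t → λ' * x t)
  balanced-scale λ' x bal e ie = trans (sym (distribˡ λ' _ _)) (trans (*-congˡ (bal e ie)) (zeroʳ λ'))

  balanced-difference : ∀ x y → Balanced x → Balanced y → Balanced (λ t → x t + - y t)
  balanced-difference x y balX balY e ie = begin
    (x t₊ + - y t₊) + (x t₋ + - y t₋) ≈⟨ interchange _ _ _ _ ⟩
    (x t₊ + x t₋) + (- y t₊ + - y t₋) ≈⟨ +-congˡ (-‿+-comm (y t₊) (y t₋)) ⟩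
    (x t₊ + x t₋) + - (y t₊ + y t₋)   ≈⟨ +-cong (balX e ie) (-‿cong (balY e ie)) ⟩
    0# + - 0#                         ≈⟨ +-identityˡ (- 0#) ⟩
    - 0#                              ≈⟨ -0#≈0# ⟩
    0#                                ∎
    where
    t₊ = plusTriangle e ie
    t₋ = minusTriangle e ie

  signedVector-balanced : ∀ a → Balanced (signedVector 𝔽 sign a)
  signedVector-balanced a e ie
    rewrite proj₁ (proj₂ (orientedP e ie)) | proj₁ (proj₂ (orientedM e ie)) = -‿inverseʳ a

  balanced-vanishing-edgeClosed : ∀ w → Balanced w → EdgeClosed isSphere (λ t → w t ≈ 0#)
  balanced-vanishing-edgeClosed w bal e {s} {t} e⊆s e⊆t w[s]≈0 =
    [ (λ t≡t₊ → ≡.subst Vanishes (≡.sym t≡t₊) (proj₁ both))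
    , (λ t≡t₋ → ≡.subst Vanishes (≡.sym t≡t₋) (proj₂ both)) ]′ (triangle-on-edge e ie e⊆t)
    where
    ie = s , e⊆s
    t₊ = plusTriangle e ie
    t₋ = minusTriangle e ie

    Vanishes : Fin m → Set ℓ
    Vanishes r = w r ≈ 0#

    fromPlus : Vanishes t₊ → Vanishes t₊ × Vanishes t₋
    fromPlus w[t₊]≈0 = w[t₊]≈0 , x+y≈0∧x≈0⇒y≈0 𝔽 (bal e ie) w[t₊]≈0

    fromMinus : Vanishes t₋ → Vanishes t₊ × Vanishes t₋
    fromMinus w[t₋]≈0 = x+y≈0∧x≈0⇒y≈0 𝔽 (trans (+-comm _ _) (bal e ie)) w[t₋]≈0 , w[t₋]≈0

    both : Vanishes t₊ × Vanishes t₋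
    both = [ (λ s≡t₊ → fromPlus (≡.subst Vanishes s≡t₊ w[s]≈0))
           , (λ s≡t₋ → fromMinus (≡.subst Vanishes s≡t₋ w[s]≈0)) ]′ (triangle-on-edge e ie e⊆s)

  balanced-multiple : ∀ v x t₀ → ¬ v t₀ ≈ 0# → Balanced v → Balanced x →
                      ∃[ λ' ] (∀ t → x t ≈ λ' * v t)
  balanced-multiple v x t₀ v≉0 balV balX with inverse (v t₀) v≉0
  ... | v⁻¹ , v*v⁻¹≈1 = λ' , λ t → x-y≈0⇒x≈y 𝔽 (vanishes-everywhere t₀≈0 t)
    where
    λ' = x t₀ * v⁻¹

    vanishes-everywhere : ∀ {s} → x s + - (λ' * v s) ≈ 0# → ∀ t → x t + - (λ' * v t) ≈ 0#
    vanishes-everywhere = edgeClosed⇒everywhere isSphere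
      (balanced-vanishing-edgeClosed _ (balanced-difference x (λ t → λ' * v t) balX (balanced-scale λ' v balV)))

    t₀≈0 : x t₀ + - (λ' * v t₀) ≈ 0#
    t₀≈0 = begin
      x t₀ + - ((x t₀ * v⁻¹) * v t₀) ≈⟨ +-congˡ (-‿cong (*-assoc (x t₀) v⁻¹ (v t₀))) ⟩
      x t₀ + - (x t₀ * (v⁻¹ * v t₀)) ≈⟨ +-congˡ (-‿cong (*-congˡ (trans (*-comm v⁻¹ (v t₀)) v*v⁻¹≈1))) ⟩
      x t₀ + - (x t₀ * 1#)           ≈⟨ +-congˡ (-‿cong (*-identityʳ (x t₀))) ⟩
      x t₀ + - x t₀                  ≈⟨ -‿inverseʳ (x t₀) ⟩
      0#                             ∎

mainTheorem7 : ∀ {c ℓ : Level} (𝔽 : Field c ℓ) (a : Field.Carrier 𝔽) →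
                 ¬ (Field._≈_ 𝔽 a (Field.0# 𝔽)) →
                 ∀ {n m : ℕ} (S : OrientedSphere n m) →
                 KernelIsSpanOf 𝔽 (OrientedSphere.complex S)
                   (signedVector 𝔽 (OrientedSphere.sign S) a)
mainTheorem7 𝔽 a a≉0 S =
    (λ v≈0 → v[t₀]≉0 (v≈0 t₀))
  , (λ λ' → balanced⇒inKernel _ (balanced-scale λ' v (signedVector-balanced a)))
  , (λ x ker → balanced-multiple v x t₀ v[t₀]≉0 (signedVector-balanced a) (inKernel⇒balanced x ker))
  where
  open OrientedSphere S
  open OrientedKernel 𝔽 S
  v = signedVector 𝔽 sign a
  t₀ = someTriangle isSphere
  v[t₀]≉0 = signedVector≉0 𝔽 a≉0 sign t₀
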